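{- For all integers $n\ge 1$ and all odd integers $k$ with $1\le k\le n$, we have $\mathbb{N}^\varphi(n,k)\le 2k+4$.
   Context: $\varphi$ denotes Euler's totient function. For a sequence $A=(a_1,a_2,a_3,\dots)$ of positive integers and an integer $n\ge 1$, the partial evaluations $A^\varphi(n,k)$ for $0\le k\le n$ are defined recursively by $A^\varphi(n,n)=0$ and $A^\varphi(n,k-1)=\varphi\big(a_k+A^\varphi(n,k)\big)$ for $1\le k\le n$. Here $\mathbb{N}^\varphi(n,k)$ denotes this with $A$ the sequence of positive integers, $a_j=j$; so for example $\mathbb{N}^\varphi(n,0)=\varphi(1+\varphi(2+\varphi(3+\cdots+\varphi(n)\cdots)))$. -}

module Defs where

open import Data.Nat using (ℕ; zero; suc; _+_; _∸_)
open import Data.Nat.GCD using (gcd)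
open import Data.List using (List; length; filter; upTo; map)
open import Relation.Binary.PropositionalEquality using (_≡_)
open import Data.Nat.Properties using (_≟_)

φ : ℕ → ℕ
φ n = length (filter (λ m → gcd m n ≟ 1) (map suc (upTo n)))

-- Auxiliary: eval k r = ℕ^φ(k + r, k), i.e. the partial evaluation at
-- position k with r further terms a_{k+1}, ..., a_{k+r} (a_j = j).
-- eval k 0 = 0 ;  eval k (r+1) = φ((k+1) + eval (k+1) r).
eval : ℕ → ℕ → ℕ
eval k zero    = 0
eval k (suc r) = φ (suc k + eval (suc k) r)

-- ℕ^φ(n, k) for 0 ≤ k ≤ n (for k > n it is not meaningful; the statement only uses k ≤ n).
Nφ : ℕ → ℕ → ℕ
Nφ n k = eval k (n ∸ k)

{-# OPTIONS --safe #-}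
module Submission where

-- φ n is even for n ≥ 3, since m ↦ n − m pairs off the residues coprime to n, and
-- φ (2h) ≤ h, since no even number is coprime to 2h. Let k be odd and assume
-- x = ℕ^φ(n, k + 2) ≤ 2k + 8 by induction. Then e = φ (k + 2 + x) is even and at most
-- the odd number 3k + 10, so e ≤ 3k + 9. Hence k + 1 + e = 2h with h ≤ 2k + 5, and
-- ℕ^φ(n, k) = φ (2h) ≤ h; as φ (2h) is even (or at most 1), it is not 2k + 5.

open import Defs
open import Data.Nat using (ℕ; zero; suc; _+_; _*_; _∸_; _≤_; _<_; z≤n; s≤s; _≟_)
open import Data.Nat.Properties
open import Data.Nat.GCD using (gcd)
open import Data.Nat.Coprimality using (gcd≡1⇒coprime; coprime⇒gcd≡1)
open import Data.Nat.Divisibility using (_∣_; divides; ∣-refl; _∣0; n∣m*n; ∣m+n∣m⇒∣n; ∣m∣n⇒∣m+n)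
open import Data.Nat.Tactic.RingSolver using (solve)
open import Data.List using ([]; _∷_; [_]; _++_; length; filter; upTo; applyUpTo; map)
open import Data.List.Properties
  using (length-++; filter-++; filter-accept; filter-reject; length-filter; upTo-∷ʳ; map-upTo; length-map; length-upTo)
open import Data.Product using (∃; _,_)
open import Data.Sum using (_⊎_; inj₁; inj₂)
open import Function using (_∘′_; case_of_)
open import Relation.Nullary using (¬_; yes; no)
open import Relation.Unary using (Decidable)
open import Relation.Binary.PropositionalEquality
  using (_≡_; _≢_; refl; sym; trans; cong; subst; module ≡-Reasoning)

m+m≡m*2 : ∀ m → m + m ≡ m * 2
m+m≡m*2 m = sym (trans (*-comm m 2) (cong (m +_) (+-identityʳ m)))

2∣m+m : ∀ m → 2 ∣ m + m
2∣m+m m = divides m (m+m≡m*2 m)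

parity-view : ∀ n → ∃ λ h → n ≡ h * 2 ⊎ n ≡ suc (h * 2)
parity-view zero = 0 , inj₁ refl
parity-view (suc n) with parity-view n
... | h , inj₁ refl = h , inj₂ refl
... | h , inj₂ refl = suc h , inj₁ refl

∣∧<[1+j]*d⇒≤j*d : ∀ {d x} j → d ∣ x → x < suc j * d → x ≤ j * d
∣∧<[1+j]*d⇒≤j*d {d} j (divides q refl) q*d<[1+j]*d =
  *-monoˡ-≤ d (≤-pred (*-cancelʳ-< d q (suc j) q*d<[1+j]*d))

module CountBelow {P : ℕ → Set} (P? : Decidable P) where

  countBelow : ℕ → ℕ
  countBelow n = length (filter P? (upTo n))

  χ : ℕ → ℕ
  χ x = length (filter P? [ x ])

  χ-yes : ∀ {x} → P x → χ x ≡ 1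
  χ-yes px = cong length (filter-accept P? px)

  χ-no : ∀ {x} → ¬ P x → χ x ≡ 0
  χ-no ¬px = cong length (filter-reject P? ¬px)

  χ≤1 : ∀ x → χ x ≤ 1
  χ≤1 x = length-filter P? [ x ]

  χ-cong : ∀ {x y} → (P x → P y) → (P y → P x) → χ x ≡ χ y
  χ-cong {x} to from = case P? x of λ where
    (yes px)  → trans (χ-yes px) (sym (χ-yes (to px)))
    (no ¬px) → trans (χ-no ¬px) (sym (χ-no (¬px ∘′ from)))

  countBelow-suc : ∀ n → countBelow (suc n) ≡ countBelow n + χ n
  countBelow-suc n = begin
    length (filter P? (upTo (suc n)))            ≡⟨ cong (length ∘′ filter P?) (sym (upTo-∷ʳ n)) ⟩
    length (filter P? (upTo n ++ [ n ]))          ≡⟨ cong length (filter-++ P? (upTo n) [ n ]) ⟩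
    length (filter P? (upTo n) ++ filter P? [ n ]) ≡⟨ length-++ (filter P? (upTo n)) ⟩
    countBelow n + χ n                            ∎
    where open ≡-Reasoning

  SymmetricAbout : ℕ → Set
  SymmetricAbout N = ∀ i j → i + j ≡ N → P j → P i

  module _ {N} (sym-N : SymmetricAbout N) where

    χ-reflect : ∀ {i j} → i + j ≡ N → χ i ≡ χ j
    χ-reflect {i} {j} i+j≡N = χ-cong (sym-N j i (trans (+-comm j i) i+j≡N)) (sym-N i j i+j≡N)

    -- i ↦ N − i maps the range [j + 1, N] onto [0, r).
    countBelow-split : ∀ j r → j + r ≡ N → countBelow (suc N) ≡ countBelow r + countBelow (suc j)
    countBelow-split zero r refl = begin
      countBelow (suc r)     ≡⟨ countBelow-suc r ⟩
      countBelow r + χ r     ≡⟨ cong (countBelow r +_) (χ-reflect (+-comm r 0)) ⟩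
      countBelow r + χ 0     ∎
      where open ≡-Reasoning
    countBelow-split (suc j) r j+r≡N = begin
      countBelow (suc N)                          ≡⟨ countBelow-split j (suc r) (trans (+-suc j r) j+r≡N) ⟩
      countBelow (suc r) + countBelow (suc j)     ≡⟨ cong (_+ countBelow (suc j)) (countBelow-suc r) ⟩
      countBelow r + χ r + countBelow (suc j)     ≡⟨ +-assoc (countBelow r) (χ r) _ ⟩
      countBelow r + (χ r + countBelow (suc j))   ≡⟨ cong (countBelow r +_) (+-comm (χ r) _) ⟩
      countBelow r + (countBelow (suc j) + χ r)   ≡⟨ cong (λ c → countBelow r + (countBelow (suc j) + c)) (χ-reflect (trans (+-comm r (suc j)) j+r≡N)) ⟩
      countBelow r + (countBelow (suc j) + χ (suc j)) ≡⟨ cong (countBelow r +_) (sym (countBelow-suc (suc j))) ⟩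
      countBelow r + countBelow (suc (suc j))     ∎
      where open ≡-Reasoning

    countBelow-even : (∀ i → i + i ≡ N → ¬ P i) → 2 ∣ countBelow (suc N)
    countBelow-even no-centre with parity-view N
    ... | h , inj₁ refl = subst (2 ∣_) (sym (begin
      countBelow (suc (h * 2))                ≡⟨ countBelow-split h h (m+m≡m*2 h) ⟩
      countBelow h + countBelow (suc h)       ≡⟨ cong (countBelow h +_) (countBelow-suc h) ⟩
      countBelow h + (countBelow h + χ h)     ≡⟨ cong (λ c → countBelow h + (countBelow h + c)) (χ-no (no-centre h (m+m≡m*2 h))) ⟩
      countBelow h + (countBelow h + 0)       ≡⟨ cong (countBelow h +_) (+-identityʳ (countBelow h)) ⟩
      countBelow h + countBelow h             ∎)) (2∣m+m (countBelow h))
      where open ≡-Reasoning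
    ... | h , inj₂ refl = subst (2 ∣_) (sym (countBelow-split h (suc h) (trans (+-suc h h) (cong suc (m+m≡m*2 h)))))
                                (2∣m+m (countBelow (suc h)))

  countBelow-≤-half : (∀ i → ¬ P (i * 2)) → ∀ h → countBelow (suc (h * 2)) ≤ h
  countBelow-≤-half no-even zero = ≤-reflexive (χ-no (no-even 0))
  countBelow-≤-half no-even (suc h) = begin
    countBelow (suc (suc h * 2))                         ≡⟨ countBelow-suc (suc (suc (h * 2))) ⟩
    countBelow (suc (suc (h * 2))) + χ (suc h * 2)       ≡⟨ cong (countBelow (suc (suc (h * 2))) +_) (χ-no (no-even (suc h))) ⟩
    countBelow (suc (suc (h * 2))) + 0                   ≡⟨ +-identityʳ _ ⟩
    countBelow (suc (suc (h * 2)))                       ≡⟨ countBelow-suc (suc (h * 2)) ⟩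
    countBelow (suc (h * 2)) + χ (suc (h * 2))           ≤⟨ +-mono-≤ (countBelow-≤-half no-even h) (χ≤1 _) ⟩
    h + 1                                                ≡⟨ +-comm h 1 ⟩
    suc h                                                ∎
    where open ≤-Reasoning

common-divisor⇒gcd≢1 : ∀ {d m n} → 2 ≤ d → d ∣ m → d ∣ n → gcd m n ≢ 1
common-divisor⇒gcd≢1 2≤d d∣m d∣n gcd≡1 = <⇒≢ 2≤d (sym (gcd≡1⇒coprime gcd≡1 (d∣m , d∣n)))

gcd≡1-reflect : ∀ {n} i j → i + j ≡ n → gcd j n ≡ 1 → gcd i n ≡ 1
gcd≡1-reflect i j refl gcd≡1 = coprime⇒gcd≡1 λ (d∣i , d∣i+j) →
  gcd≡1⇒coprime {j} gcd≡1 (∣m+n∣m⇒∣n d∣i+j d∣i , d∣i+j)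

coprimeTo? : ∀ n → Decidable (λ m → gcd m n ≡ 1)
coprimeTo? n m = gcd m n ≟ 1

module _ (n : ℕ) where
  open CountBelow (coprimeTo? n)

  χ0+φ≡countBelow : χ 0 + φ n ≡ countBelow (suc n)
  χ0+φ≡countBelow = begin
    χ 0 + φ n                               ≡⟨ cong (λ xs → χ 0 + length (filter c? xs)) (map-upTo suc n) ⟩
    χ 0 + length (filter c? (applyUpTo suc n))   ≡⟨ sym (length-++ (filter c? [ 0 ])) ⟩
    length (filter c? [ 0 ] ++ filter c? (applyUpTo suc n)) ≡⟨ cong length (sym (filter-++ c? [ 0 ] (applyUpTo suc n))) ⟩
    countBelow (suc n)                      ∎
    where
    open ≡-Reasoning
    c? = coprimeTo? n

  φ≤countBelow : φ n ≤ countBelow (suc n)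
  φ≤countBelow = subst (φ n ≤_) χ0+φ≡countBelow (m≤n+m (φ n) (χ 0))

  φ≡countBelow : 2 ≤ n → φ n ≡ countBelow (suc n)
  φ≡countBelow 2≤n = begin
    φ n              ≡⟨⟩
    0 + φ n          ≡⟨ cong (_+ φ n) (sym (χ-no {0} (common-divisor⇒gcd≢1 2≤n (n ∣0) ∣-refl))) ⟩
    χ 0 + φ n        ≡⟨ χ0+φ≡countBelow ⟩
    countBelow (suc n) ∎
    where open ≡-Reasoning

φ≤n : ∀ n → φ n ≤ n
φ≤n n = begin
  φ n                       ≤⟨ length-filter (coprimeTo? n) (map suc (upTo n)) ⟩
  length (map suc (upTo n)) ≡⟨ length-map suc (upTo n) ⟩
  length (upTo n)           ≡⟨ length-upTo n ⟩
  n                         ∎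
  where open ≤-Reasoning

φ[h*2]≤h : ∀ h → φ (h * 2) ≤ h
φ[h*2]≤h h = ≤-trans (φ≤countBelow (h * 2)) (countBelow-≤-half no-even h)
  where
  open CountBelow (coprimeTo? (h * 2))
  no-even : ∀ i → gcd (i * 2) (h * 2) ≢ 1
  no-even i = common-divisor⇒gcd≢1 ≤-refl (n∣m*n i) (n∣m*n h)

φ-even : ∀ {n} → 3 ≤ n → 2 ∣ φ n
φ-even {n} 3≤n = subst (2 ∣_) (sym (φ≡countBelow n (≤-trans (n≤1+n 2) 3≤n)))
                       (countBelow-even gcd≡1-reflect centre-not-coprime)
  where
  open CountBelow (coprimeTo? n)
  centre-not-coprime : ∀ i → i + i ≡ n → gcd i n ≢ 1
  centre-not-coprime i i+i≡n =
    common-divisor⇒gcd≢1 2≤i ∣-refl (subst (i ∣_) i+i≡n (∣m∣n⇒∣m+n ∣-refl ∣-refl))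
    where
    2≤i : 2 ≤ i
    2≤i = *-cancelʳ-< 2 1 i (subst (3 ≤_) (trans (sym i+i≡n) (m+m≡m*2 i)) 3≤n)

φ≤1+[1+j]*2⇒φ≤[1+j]*2 : ∀ n j → φ n ≤ suc (suc j * 2) → φ n ≤ suc j * 2
φ≤1+[1+j]*2⇒φ≤[1+j]*2 0 j _ = z≤n
φ≤1+[1+j]*2⇒φ≤[1+j]*2 1 j _ = s≤s z≤n
φ≤1+[1+j]*2⇒φ≤[1+j]*2 2 j _ = s≤s z≤n
φ≤1+[1+j]*2⇒φ≤[1+j]*2 n@(suc (suc (suc _))) j φn≤ =
  ∣∧<[1+j]*d⇒≤j*d (suc j) (φ-even {n} (s≤s (s≤s (s≤s z≤n)))) (s≤s φn≤)

φ-two-steps≤ : ∀ m {x} → let k = suc (m * 2) in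
               x ≤ 2 * (2 + k) + 4 → φ (suc k + φ (2 + k + x)) ≤ 2 * k + 4
φ-two-steps≤ m {x} x≤ with φ-even {3 + m * 2 + x} (s≤s (s≤s (s≤s z≤n)))
... | divides t φy≡t*2 = begin
  φ (2 + m * 2 + φ (3 + m * 2 + x))    ≡⟨ cong (λ e → φ (2 + m * 2 + e)) φy≡t*2 ⟩
  φ (2 + m * 2 + t * 2)                ≡⟨ cong φ regroup ⟩
  φ ((suc m + t) * 2)                  ≤⟨ φ≤1+[1+j]*2⇒φ≤[1+j]*2 ((suc m + t) * 2) (2 + m * 2) φ≤ ⟩
  (3 + m * 2) * 2                      ≡⟨ solve (m ∷ []) ⟩
  2 * suc (m * 2) + 4                  ∎
  where
  open ≤-Reasoning

  regroup : 2 + m * 2 + t * 2 ≡ (suc m + t) * 2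
  regroup = solve (m ∷ t ∷ [])

  t≤ : t ≤ 6 + m * 3
  t≤ = ≤-pred (*-cancelʳ-< 2 t (7 + m * 3) (begin-strict
    t * 2                                 ≡⟨ sym φy≡t*2 ⟩
    φ (3 + m * 2 + x)                     ≤⟨ φ≤n (3 + m * 2 + x) ⟩
    3 + m * 2 + x                         <⟨ s≤s (+-monoʳ-≤ (3 + m * 2) x≤) ⟩
    4 + m * 2 + (2 * (3 + m * 2) + 4)     ≡⟨ solve (m ∷ []) ⟩
    (7 + m * 3) * 2                       ∎))

  φ≤ : φ ((suc m + t) * 2) ≤ suc ((3 + m * 2) * 2)
  φ≤ = begin
    φ ((suc m + t) * 2)   ≤⟨ φ[h*2]≤h (suc m + t) ⟩
    suc m + t             ≤⟨ +-monoʳ-≤ (suc m) t≤ ⟩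
    suc m + (6 + m * 3)   ≡⟨ solve (m ∷ []) ⟩
    suc ((3 + m * 2) * 2) ∎

eval-odd≤ : ∀ m r → eval (suc (m * 2)) r ≤ 2 * suc (m * 2) + 4
eval-odd≤ m zero = z≤n
eval-odd≤ m (suc zero) = begin
  φ (2 + m * 2 + 0)     ≤⟨ φ≤n (2 + m * 2 + 0) ⟩
  2 + m * 2 + 0         ≤⟨ m≤m+n (2 + m * 2 + 0) (m * 2 + 4) ⟩
  2 + m * 2 + 0 + (m * 2 + 4) ≡⟨ solve (m ∷ []) ⟩
  2 * suc (m * 2) + 4   ∎
  where open ≤-Reasoning
eval-odd≤ m (suc (suc r)) = φ-two-steps≤ m (eval-odd≤ (suc m) r)

-- The bound holds at every odd position.
lemma2p1 : (n k : ℕ) → 1 ≤ n → (∃ λ m → k ≡ 2 * m + 1) → 1 ≤ k → k ≤ n → Nφ n k ≤ 2 * k + 4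
lemma2p1 n k _ (m , k≡2m+1) _ _ =
  subst (λ k → Nφ n k ≤ 2 * k + 4) (trans odd-form (sym k≡2m+1)) (eval-odd≤ m (n ∸ suc (m * 2)))
  where
  odd-form : suc (m * 2) ≡ 2 * m + 1
  odd-form = solve (m ∷ [])
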